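{- Let $m,q$ be positive integers and let $(\Delta^{(n)}_{m,q})_{n\ge0}$ be the iterated $q$-cones with initial condition $m$. Let $\bm F_{m,q}=(f_{n,k})_{n,k\ge0}$ be the infinite matrix whose $n$-th row is $(f_{n,0},\ldots,f_{n,n},0,0,\ldots)$, the $f$-vector of $\Delta^{(n)}_{m,q}$ ($f_{n,k}$ = number of $k$-dimensional faces), and let $P_n(x)=\sum_k f_{n,k}x^k$ be the $f$-polynomial of $\Delta^{(n)}_{m,q}$. Then: (a) $P_0(x)=m$ and $P_n(x)=(qx+1)P_{n-1}(x)+q$ for $n\ge1$. (b) $\bm F_{m,q}$ is a Riordan matrix; namely $\bm F_{m,q}=T\!\left(\frac{m+(q-m)x}{q(1-x)}\,\Big|\,\frac{1-x}{q}\right)$. (c) $f_{0,0}=m$, $f_{n,0}=f_{n-1,0}+q$ for $n\ge1$, and $f_{n,k}=f_{n-1,k}+qf_{n-1,k-1}$ for all $n,k\ge1$. (d) For all $n,k\ge0$, $f_{n,k}=\left[q\binom{n}{k+1}+m\binom nk\right]q^k$. (e) $P_n(x)=m(qx+1)^{n}+q\sum_{j=0}^{n-1}(qx+1)^j$.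
   Context: $[k]$ denotes the $0$-dimensional simplicial complex with $k$ vertices. The join is $\mathcal F*\mathcal K=\{\sigma\cup\tau:\sigma\in\mathcal F\cup\{\emptyset\},\tau\in\mathcal K\cup\{\emptyset\}\}$ (on disjoint vertex sets). Define $\Delta^{(0)}_{m,q}=[m]$ and $\Delta^{(n)}_{m,q}=\Delta^{(n-1)}_{m,q}*[q]$ for $n\ge1$ (with $q$ new vertices each time). For $\alpha,\omega\in\mathbb C[[x]]$ with $\alpha(0),\omega(0)\ne0$, $T(\alpha\mid\omega)$ is the infinite lower triangular matrix $(d_{ij})_{i,j\ge0}$ with $d_{ij}=[x^i]\,x^j\alpha(x)/\omega(x)^{j+1}$; such matrices are called Riordan matrices. -}

module Defs where

open import Data.Nat as ℕ using (ℕ; zero; suc; NonZero)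
open import Data.Nat.Combinatorics using (_C_)
open import Data.Fin using (Fin)
open import Data.Sum using (_⊎_; inj₁; inj₂)
open import Data.List using (List; []; _∷_; [_]; map; concatMap; length; filter; _++_; upTo; allFin; foldr; zipWith)
open import Data.Integer as ℤ using (+_)
open import Data.Product using (_×_)
open import Relation.Binary.PropositionalEquality using (_≡_)
open import Relation.Nullary using (¬_)
open import Data.Rational as ℚ using (ℚ; 0ℚ; 1ℚ; _/_)
open import Data.Rational.Properties using () renaming (_≟_ to _≟ℚ_)
open import Relation.Nullary using (yes; no)

-- Finite simplicial complexes, given by their list of faces (each face
-- a list of vertices).  By convention the list contains the empty face.

Complex : Set → Set
Complex V = List (List V)

pts : (k : ℕ) → Complex (Fin k)
pts k = [] ∷ map [_] (allFin k)

-- join on disjoint vertex sets:  { σ ∪ τ : σ ∈ F ∪ {∅}, τ ∈ K ∪ {∅} }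
-- (∅ already belongs to F and K, so F ∪ {∅} = F, K ∪ {∅} = K)
join : {V W : Set} → Complex V → Complex W → Complex (V ⊎ W)
join F K = concatMap (λ σ → map (λ τ → map inj₁ σ ++ map inj₂ τ) K) F

Vert : ℕ → ℕ → ℕ → Set
Vert m q zero    = Fin m
Vert m q (suc n) = Vert m q n ⊎ Fin q

Δ : (m q n : ℕ) → Complex (Vert m q n)
Δ m q zero    = pts m
Δ m q (suc n) = join (Δ m q n) (pts q)

fnum : {V : Set} → Complex V → ℕ → ℕ
fnum F k = length (filter (λ σ → length σ ℕ.≟ suc k) F)

f : (m q n k : ℕ) → ℕ
f m q n k = fnum (Δ m q n) k

PolyN : Set
PolyN = ℕ → ℕ

sumN : List ℕ → ℕ
sumN = foldr ℕ._+_ 0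

_⊕_ : PolyN → PolyN → PolyN
(a ⊕ b) k = a k ℕ.+ b k

_⊛_ : PolyN → PolyN → PolyN
(a ⊛ b) k = sumN (map (λ i → a i ℕ.* b (k ℕ.∸ i)) (upTo (suc k)))

constN : ℕ → PolyN
constN c zero    = c
constN c (suc _) = 0

qx+1 : ℕ → PolyN
qx+1 q zero          = 1
qx+1 q (suc zero)    = q
qx+1 q (suc (suc _)) = 0

powN : PolyN → ℕ → PolyN
powN a zero    = constN 1
powN a (suc j) = a ⊛ powN a j

sumPolyN : ℕ → (ℕ → PolyN) → PolyN
sumPolyN zero    p = constN 0
sumPolyN (suc n) p = sumPolyN n p ⊕ p n

P : (m q n : ℕ) → PolyN
P m q n k = f m q n k

Series : Set
Series = ℕ → ℚ

sumQ : List ℚ → ℚ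
sumQ = foldr ℚ._+_ 0ℚ

_·_ : Series → Series → Series
(a · b) k = sumQ (map (λ i → a i ℚ.* b (k ℕ.∸ i)) (upTo (suc k)))

oneS : Series
oneS zero    = 1ℚ
oneS (suc _) = 0ℚ

powS : Series → ℕ → Series
powS a zero    = oneS
powS a (suc j) = a · powS a j

shift : ℕ → Series → Series
shift j a k with k ℕ.<? j
... | yes _ = 0ℚ
... | no  _ = a (k ℕ.∸ j)

-- multiplicative inverse of a series with a(0) ≠ 0, via
-- b_0 = 1/a_0,  b_n = -(1/a_0) Σ_{i=1}^{n} a_i b_{n-i}.
-- (When a(0) = 0 the value is an irrelevant junk value 0.)
module _ (a : Series) (c : ℚ) where
  -- list [b_n, ..., b_0]
  invUpTo : ℕ → List ℚ
  invUpTo zero    = c ∷ []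
  invUpTo (suc n) =
    let bs = invUpTo n in
    (ℚ.- c ℚ.* sumQ (zipWith ℚ._*_ bs (map (λ i → a (suc i)) (upTo (suc n))))) ∷ bs

headQ : List ℚ → ℚ
headQ []      = 0ℚ
headQ (x ∷ _) = x

inv : Series → Series
inv a n with a 0 ≟ℚ 0ℚ
... | yes _ = 0ℚ
... | no a0≢0 = headQ (invUpTo a (ℚ.1/_ (a 0) {{ℚ.≢-nonZero a0≢0}}) n)

T : Series → Series → ℕ → ℕ → ℚ
T α ω i j = shift j (α · inv (powS ω (suc j))) i

IsRiordanT : (ℕ → ℕ → ℚ) → Series → Series → Set
IsRiordanT M α ω =
  ¬ (α 0 ≡ 0ℚ) × ¬ (ω 0 ≡ 0ℚ) × (∀ i j → M i j ≡ T α ω i j)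

ℕtoℚ : ℕ → ℚ
ℕtoℚ n = + n / 1

Fmat : (m q : ℕ) → ℕ → ℕ → ℚ
Fmat m q n k = ℕtoℚ (f m q n k)

αS : (m q : ℕ) → Series
αS m q = num · inv den
  where
  num : Series
  num zero          = ℕtoℚ m
  num (suc zero)    = (+ q ℤ.- + m) / 1
  num (suc (suc _)) = 0ℚ
  den : Series
  den zero          = ℕtoℚ q
  den (suc zero)    = ℚ.- ℕtoℚ q
  den (suc (suc _)) = 0ℚ

ωS : (q : ℕ) → .{{_ : NonZero q}} → Series
ωS q zero          = + 1 / q
ωS q (suc zero)    = ℚ.- (+ 1 / q)
ωS q (suc (suc _)) = 0ℚ

{-# OPTIONS --safe #-}
module Submission where

-- Joining a complex with [q] multiplies its face polynomial (empty face included) by 1 + qx.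
-- This gives the recursion (c); (a), the closed form (d) (by Pascal's rule) and (e) follow by
-- induction on n.
--
-- For (b), write ω = (1 - x)/q.  The series 1/ω^j = q^j/(1 - x)^j arises from 1 by j rounds
-- of "multiply by q, take partial sums", and convolving with α commutes with both operations.
-- So the j-th column of T(α | ω), read from its diagonal entry on, is the series of partial
-- sums of q times the previous column, column 0 arising in the same way from α itself.  By (c)
-- the columns of F obey the same recursion, and both start from qα = (m, q, q, …), as
-- α = (m + (q - m)x)/(q(1 - x)) = m/q + x/(1 - x).

open import Defs
open import Data.Nat using (ℕ; zero; suc; NonZero)
open import Data.Nat.Combinatorics using (_C_)
open import Data.Product using (_×_; _,_)
open import Relation.Binary.PropositionalEquality using (_≡_; refl; sym; trans; cong; cong₂; module ≡-Reasoning)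

module FaceCounts where
  open import Data.Nat using (_+_; _*_; _≡ᵇ_; _≟_)
  open import Data.Nat.Properties using (+-identityʳ; +-comm; *-zeroʳ)
  open import Data.Nat.Solver using (module +-*-Solver)
  open import Data.Bool using (if_then_else_; true; false)
  open import Data.List using (List; []; _∷_; [_]; map; filter; length; _++_; allFin)
  open import Data.List.Properties using (filter-++; length-++; length-map; length-tabulate; map-∘)
  open import Data.Sum using (_⊎_; inj₁; inj₂)
  open import Function using (id)
  open +-*-Solver
  open ≡-Reasoning

  -- Faces are counted by their number of vertices, the empty face included, so that
  -- f m q n k is faceCount (Δ m q n) (suc k) by definition.
  faceCount : {V : Set} → Complex V → ℕ → ℕ
  faceCount F k = length (filter (λ σ → length σ ≟ k) F)

  δ : ℕ → ℕ → ℕ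
  δ a b = if a ≡ᵇ b then 1 else 0

  faceCount-∷ : ∀ {V} (σ : List V) F k → faceCount (σ ∷ F) k ≡ δ (length σ) k + faceCount F k
  faceCount-∷ σ F k with length σ ≡ᵇ k
  ... | true  = refl
  ... | false = refl

  faceCount-++ : ∀ {V} (F G : Complex V) k → faceCount (F ++ G) k ≡ faceCount F k + faceCount G k
  faceCount-++ F G k = trans (cong length (filter-++ _ F G)) (length-++ (filter _ F))

  faceCount-equisized : ∀ {A V : Set} (g : A → List V) ℓ → (∀ a → length (g a) ≡ ℓ) →
                        ∀ xs k → faceCount (map g xs) k ≡ length xs * δ ℓ k
  faceCount-equisized g ℓ g-size []       k = refl
  faceCount-equisized g ℓ g-size (x ∷ xs) k =
    trans (faceCount-∷ (g x) (map g xs) k)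
          (cong₂ _+_ (cong (λ s → δ s k) (g-size x)) (faceCount-equisized g ℓ g-size xs k))

  faceCount-pts : ∀ q k → faceCount (pts q) k ≡ δ 0 k + q * δ 1 k
  faceCount-pts q k =
    trans (faceCount-∷ [] (map [_] (allFin q)) k)
          (cong (δ 0 k +_) (trans (faceCount-equisized [_] 1 (λ _ → refl) (allFin q) k)
                                  (cong (_* δ 1 k) (length-tabulate {n = q} id))))

  _⊔_ : {V W : Set} → List V → List W → List (V ⊎ W)
  σ ⊔ τ = map inj₁ σ ++ map inj₂ τ

  length-⊔ : ∀ {V W : Set} (σ : List V) (τ : List W) → length (σ ⊔ τ) ≡ length σ + length τ
  length-⊔ σ τ = trans (length-++ (map inj₁ σ)) (cong₂ _+_ (length-map inj₁ σ) (length-map inj₂ τ))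

  faceCount-cone : ∀ {V} q (σ : List V) k →
                   faceCount (map (σ ⊔_) (pts q)) k ≡ δ (length σ) k + q * δ (suc (length σ)) k
  faceCount-cone q σ k = begin
    faceCount (map (σ ⊔_) (pts q)) k
      ≡⟨ faceCount-∷ (σ ⊔ []) (map (σ ⊔_) (map [_] (allFin q))) k ⟩
    δ (length (σ ⊔ [])) k + faceCount (map (σ ⊔_) (map [_] (allFin q))) k
      ≡⟨ cong₂ _+_ (cong (λ s → δ s k) (trans (length-⊔ σ []) (+-identityʳ _)))
                   (cong (λ F → faceCount F k) (sym (map-∘ (allFin q)))) ⟩
    δ (length σ) k + faceCount (map (λ v → σ ⊔ [ v ]) (allFin q)) k
      ≡⟨ cong (δ (length σ) k +_) (faceCount-equisized _ (suc (length σ)) σ⊔v-size (allFin q) k) ⟩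
    δ (length σ) k + length (allFin q) * δ (suc (length σ)) k
      ≡⟨ cong (λ n → δ (length σ) k + n * δ (suc (length σ)) k) (length-tabulate {n = q} id) ⟩
    δ (length σ) k + q * δ (suc (length σ)) k ∎
    where
    σ⊔v-size : ∀ v → length (σ ⊔ [ v ]) ≡ suc (length σ)
    σ⊔v-size v = trans (length-⊔ σ [ v ]) (+-comm (length σ) 1)

  faceCount-join-pts-zero : ∀ {V} (F : Complex V) q → faceCount (join F (pts q)) 0 ≡ faceCount F 0
  faceCount-join-pts-zero []      q = refl
  faceCount-join-pts-zero (σ ∷ F) q = begin
    faceCount (map (σ ⊔_) (pts q) ++ join F (pts q)) 0
      ≡⟨ faceCount-++ (map (σ ⊔_) (pts q)) (join F (pts q)) 0 ⟩
    faceCount (map (σ ⊔_) (pts q)) 0 + faceCount (join F (pts q)) 0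
      ≡⟨ cong₂ _+_ (faceCount-cone q σ 0) (faceCount-join-pts-zero F q) ⟩
    δ (length σ) 0 + q * 0 + faceCount F 0
      ≡⟨ cong (λ n → δ (length σ) 0 + n + faceCount F 0) (*-zeroʳ q) ⟩
    δ (length σ) 0 + 0 + faceCount F 0
      ≡⟨ cong (_+ faceCount F 0) (+-identityʳ _) ⟩
    δ (length σ) 0 + faceCount F 0
      ≡⟨ faceCount-∷ σ F 0 ⟨
    faceCount (σ ∷ F) 0 ∎

  faceCount-join-pts-suc : ∀ {V} (F : Complex V) q k →
                           faceCount (join F (pts q)) (suc k) ≡ faceCount F (suc k) + q * faceCount F k
  faceCount-join-pts-suc []      q k = sym (*-zeroʳ q)
  faceCount-join-pts-suc (σ ∷ F) q k = begin
    faceCount (map (σ ⊔_) (pts q) ++ join F (pts q)) (suc k)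
      ≡⟨ faceCount-++ (map (σ ⊔_) (pts q)) (join F (pts q)) (suc k) ⟩
    faceCount (map (σ ⊔_) (pts q)) (suc k) + faceCount (join F (pts q)) (suc k)
      ≡⟨ cong₂ _+_ (faceCount-cone q σ (suc k)) (faceCount-join-pts-suc F q k) ⟩
    (d₁ + q * d₀) + (c₁ + q * c₀)
      ≡⟨ solve 5 (λ d₁ d₀ c₁ c₀ q → (d₁ :+ q :* d₀) :+ (c₁ :+ q :* c₀) := (d₁ :+ c₁) :+ q :* (d₀ :+ c₀))
               refl d₁ d₀ c₁ c₀ q ⟩
    (d₁ + c₁) + q * (d₀ + c₀)
      ≡⟨ cong₂ (λ a b → a + q * b) (faceCount-∷ σ F (suc k)) (faceCount-∷ σ F k) ⟨
    faceCount (σ ∷ F) (suc k) + q * faceCount (σ ∷ F) k ∎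
    where
    d₁ = δ (length σ) (suc k)
    d₀ = δ (length σ) k
    c₁ = faceCount F (suc k)
    c₀ = faceCount F k

module IteratedCones (m q : ℕ) where
  open import Data.Nat using (_+_; _*_; _^_; _<_)
  open import Data.Nat.Properties using (*-zeroʳ; *-identityʳ; m<n⇒m<1+n)
  open import Data.Nat.Combinatorics using (k>n⇒nCk≡0; nCk+nC[k+1]≡[n+1]C[k+1]; nC1≡n)
  open import Data.Nat.Solver using (module +-*-Solver)
  open FaceCounts
  open +-*-Solver
  open ≡-Reasoning

  faceCount-Δ-zero : ∀ n → faceCount (Δ m q n) 0 ≡ 1
  faceCount-Δ-zero zero    = trans (faceCount-pts m 0) (cong suc (*-zeroʳ m))
  faceCount-Δ-zero (suc n) = trans (faceCount-join-pts-zero (Δ m q n) q) (faceCount-Δ-zero n)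

  f-zero-zero : f m q 0 0 ≡ m
  f-zero-zero = trans (faceCount-pts m 1) (*-identityʳ m)

  f-zero-suc : ∀ k → f m q 0 (suc k) ≡ 0
  f-zero-suc k = trans (faceCount-pts m (suc (suc k))) (*-zeroʳ m)

  f-suc-zero : ∀ n → f m q (suc n) 0 ≡ f m q n 0 + q
  f-suc-zero n = begin
    f m q (suc n) 0                       ≡⟨ faceCount-join-pts-suc (Δ m q n) q 0 ⟩
    f m q n 0 + q * faceCount (Δ m q n) 0 ≡⟨ cong (λ e → f m q n 0 + q * e) (faceCount-Δ-zero n) ⟩
    f m q n 0 + q * 1                     ≡⟨ cong (f m q n 0 +_) (*-identityʳ q) ⟩
    f m q n 0 + q                         ∎

  f-suc-suc : ∀ n k → f m q (suc n) (suc k) ≡ f m q n (suc k) + q * f m q n k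
  f-suc-suc n k = faceCount-join-pts-suc (Δ m q n) q (suc k)

  f-closed : ∀ n k → f m q n k ≡ (q * (n C suc k) + m * (n C k)) * q ^ k
  f-closed zero zero = begin
    f m q 0 0              ≡⟨ f-zero-zero ⟩
    m                      ≡⟨ solve 2 (λ q m → m := (q :* con 0 :+ m :* con 1) :* con 1) refl q m ⟩
    (q * 0 + m * 1) * 1    ∎
  f-closed zero (suc k) = begin
    f m q 0 (suc k)                                       ≡⟨ f-zero-suc k ⟩
    0                                                     ≡⟨ solve 3 (λ q m r → con 0 := (q :* con 0 :+ m :* con 0) :* r)
                                                                   refl q m (q ^ suc k) ⟩
    (q * (0 C suc (suc k)) + m * (0 C suc k)) * q ^ suc k ∎
  f-closed (suc n) zero = begin
    f m q (suc n) 0                  ≡⟨ f-suc-zero n ⟩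
    f m q n 0 + q                    ≡⟨ cong (_+ q) (f-closed n 0) ⟩
    (q * (n C 1) + m * 1) * 1 + q    ≡⟨ cong (λ c → (q * c + m * 1) * 1 + q) (nC1≡n n) ⟩
    (q * n + m * 1) * 1 + q          ≡⟨ solve 3 (λ q n m → (q :* n :+ m :* con 1) :* con 1 :+ q
                                                          := (q :* (con 1 :+ n) :+ m :* con 1) :* con 1)
                                                 refl q n m ⟩
    (q * suc n + m * 1) * 1          ≡⟨ cong (λ c → (q * c + m * 1) * 1) (nC1≡n (suc n)) ⟨
    (q * (suc n C 1) + m * 1) * 1    ∎
  f-closed (suc n) (suc k) = begin
    f m q (suc n) (suc k)
      ≡⟨ f-suc-suc n k ⟩
    f m q n (suc k) + q * f m q n k
      ≡⟨ cong₂ (λ x y → x + q * y) (f-closed n (suc k)) (f-closed n k) ⟩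
    (q * c₂ + m * c₁) * (q * r) + q * ((q * c₁ + m * c₀) * r)
      ≡⟨ solve 6 (λ c₂ c₁ c₀ q m r → (q :* c₂ :+ m :* c₁) :* (q :* r) :+ q :* ((q :* c₁ :+ m :* c₀) :* r)
                                  := (q :* (c₁ :+ c₂) :+ m :* (c₀ :+ c₁)) :* (q :* r))
               refl c₂ c₁ c₀ q m r ⟩
    (q * (c₁ + c₂) + m * (c₀ + c₁)) * (q * r)
      ≡⟨ cong₂ (λ x y → (q * x + m * y) * (q * r))
               (nCk+nC[k+1]≡[n+1]C[k+1] n (suc k)) (nCk+nC[k+1]≡[n+1]C[k+1] n k) ⟩
    (q * (suc n C suc (suc k)) + m * (suc n C suc k)) * q ^ suc k ∎
    where
    c₂ = n C suc (suc k)
    c₁ = n C suc k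
    c₀ = n C k
    r  = q ^ k

  f-above-diagonal : ∀ {n k} → n < k → f m q n k ≡ 0
  f-above-diagonal {n} {k} n<k = begin
    f m q n k                                 ≡⟨ f-closed n k ⟩
    (q * (n C suc k) + m * (n C k)) * q ^ k   ≡⟨ cong₂ (λ a b → (q * a + m * b) * q ^ k)
                                                       (k>n⇒nCk≡0 (m<n⇒m<1+n n<k)) (k>n⇒nCk≡0 n<k) ⟩
    (q * 0 + m * 0) * q ^ k                   ≡⟨ cong₂ (λ a b → (a + b) * q ^ k) (*-zeroʳ q) (*-zeroʳ m) ⟩
    0                                         ∎

module NatPolynomials where
  open import Data.Nat using (_+_; _*_; _^_)
  open import Data.Nat.Properties using (+-identityʳ; *-identityˡ; +-comm; *-distribʳ-+)
  open import Data.Nat.Combinatorics using (nCk+nC[k+1]≡[n+1]C[k+1])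
  open import Data.Nat.Solver using (module +-*-Solver)
  open import Data.List.Properties using (map-applyUpTo)
  open import Function using (_∘_; id)
  open +-*-Solver
  open ≡-Reasoning

  ⊛-suc : ∀ a b k → (a ⊛ b) (suc k) ≡ a 0 * b (suc k) + ((a ∘ suc) ⊛ b) k
  ⊛-suc a b k = cong (λ xs → a 0 * b (suc k) + sumN xs)
                     (trans (map-applyUpTo suc _ (suc k)) (sym (map-applyUpTo id _ (suc k))))

  zero-⊛ : ∀ b k → ((λ _ → 0) ⊛ b) k ≡ 0
  zero-⊛ b zero    = refl
  zero-⊛ b (suc k) = trans (⊛-suc (λ _ → 0) b k) (zero-⊛ b k)

  constN-⊛ : ∀ c b k → (constN c ⊛ b) k ≡ c * b k
  constN-⊛ c b zero    = +-identityʳ (c * b 0)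
  constN-⊛ c b (suc k) =
    trans (⊛-suc (constN c) b k) (trans (cong (c * b (suc k) +_) (zero-⊛ b k)) (+-identityʳ _))

  qx+1-⊛-zero : ∀ q b → (qx+1 q ⊛ b) 0 ≡ b 0
  qx+1-⊛-zero q b = trans (+-identityʳ (1 * b 0)) (*-identityˡ (b 0))

  qx+1-⊛-suc : ∀ q b k → (qx+1 q ⊛ b) (suc k) ≡ b (suc k) + q * b k
  qx+1-⊛-suc q b k = trans (⊛-suc (qx+1 q) b k) (cong₂ _+_ (*-identityˡ (b (suc k))) (q-⊛ k))
    where
    q-⊛ : ∀ k → ((qx+1 q ∘ suc) ⊛ b) k ≡ q * b k
    q-⊛ zero    = +-identityʳ (q * b 0)
    q-⊛ (suc k) =
      trans (⊛-suc (qx+1 q ∘ suc) b k) (trans (cong (q * b (suc k) +_) (zero-⊛ b k)) (+-identityʳ _))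

  powN-qx+1 : ∀ q n k → powN (qx+1 q) n k ≡ (n C k) * q ^ k
  powN-qx+1 q zero    zero    = refl
  powN-qx+1 q zero    (suc k) = refl
  powN-qx+1 q (suc n) zero    = trans (qx+1-⊛-zero q (powN (qx+1 q) n)) (powN-qx+1 q n zero)
  powN-qx+1 q (suc n) (suc k) = begin
    (qx+1 q ⊛ powN (qx+1 q) n) (suc k)
      ≡⟨ qx+1-⊛-suc q (powN (qx+1 q) n) k ⟩
    powN (qx+1 q) n (suc k) + q * powN (qx+1 q) n k
      ≡⟨ cong₂ (λ x y → x + q * y) (powN-qx+1 q n (suc k)) (powN-qx+1 q n k) ⟩
    (n C suc k) * (q * q ^ k) + q * ((n C k) * q ^ k)
      ≡⟨ solve 4 (λ a b q r → a :* (q :* r) :+ q :* (b :* r) := (b :+ a) :* (q :* r)) refl (n C suc k) (n C k) q (q ^ k) ⟩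
    ((n C k) + (n C suc k)) * (q * q ^ k)
      ≡⟨ cong (_* (q * q ^ k)) (nCk+nC[k+1]≡[n+1]C[k+1] n k) ⟩
    (suc n C suc k) * q ^ suc k ∎

  sumPolyN-powN-qx+1 : ∀ q n k → sumPolyN n (powN (qx+1 q)) k ≡ (n C suc k) * q ^ k
  sumPolyN-powN-qx+1 q zero    zero    = refl
  sumPolyN-powN-qx+1 q zero    (suc k) = refl
  sumPolyN-powN-qx+1 q (suc n) k = begin
    sumPolyN n (powN (qx+1 q)) k + powN (qx+1 q) n k ≡⟨ cong₂ _+_ (sumPolyN-powN-qx+1 q n k) (powN-qx+1 q n k) ⟩
    (n C suc k) * q ^ k + (n C k) * q ^ k            ≡⟨ *-distribʳ-+ (q ^ k) (n C suc k) (n C k) ⟨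
    ((n C suc k) + (n C k)) * q ^ k                  ≡⟨ cong (_* q ^ k) (+-comm (n C suc k) (n C k)) ⟩
    ((n C k) + (n C suc k)) * q ^ k                  ≡⟨ cong (_* q ^ k) (nCk+nC[k+1]≡[n+1]C[k+1] n k) ⟩
    (suc n C suc k) * q ^ k                          ∎

module FPolynomial (m q : ℕ) where
  open import Data.Nat using (_+_; _*_; _^_)
  open import Data.Nat.Properties using (+-identityʳ)
  open import Data.Nat.Solver using (module +-*-Solver)
  open IteratedCones m q
  open NatPolynomials
  open +-*-Solver
  open ≡-Reasoning

  P-zero : ∀ k → P m q 0 k ≡ constN m k
  P-zero zero    = f-zero-zero
  P-zero (suc k) = f-zero-suc k

  P-suc : ∀ n k → P m q (suc n) k ≡ ((qx+1 q ⊛ P m q n) ⊕ constN q) k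
  P-suc n zero    = trans (f-suc-zero n) (cong (_+ q) (sym (qx+1-⊛-zero q (P m q n))))
  P-suc n (suc k) = begin
    f m q (suc n) (suc k)              ≡⟨ f-suc-suc n k ⟩
    f m q n (suc k) + q * f m q n k    ≡⟨ qx+1-⊛-suc q (P m q n) k ⟨
    (qx+1 q ⊛ P m q n) (suc k)         ≡⟨ +-identityʳ _ ⟨
    (qx+1 q ⊛ P m q n) (suc k) + 0     ∎

  P-closed : ∀ n k → P m q n k ≡ ((constN m ⊛ powN (qx+1 q) n) ⊕ (constN q ⊛ sumPolyN n (powN (qx+1 q)))) k
  P-closed n k = begin
    f m q n k
      ≡⟨ f-closed n k ⟩
    (q * (n C suc k) + m * (n C k)) * q ^ k
      ≡⟨ solve 5 (λ q a m b r → (q :* a :+ m :* b) :* r := m :* (b :* r) :+ q :* (a :* r))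
               refl q (n C suc k) m (n C k) (q ^ k) ⟩
    m * ((n C k) * q ^ k) + q * ((n C suc k) * q ^ k)
      ≡⟨ cong₂ (λ x y → m * x + q * y) (powN-qx+1 q n k) (sumPolyN-powN-qx+1 q n k) ⟨
    m * powN (qx+1 q) n k + q * sumPolyN n (powN (qx+1 q)) k
      ≡⟨ cong₂ _+_ (constN-⊛ m (powN (qx+1 q) n) k) (constN-⊛ q (sumPolyN n (powN (qx+1 q))) k) ⟨
    ((constN m ⊛ powN (qx+1 q) n) ⊕ (constN q ⊛ sumPolyN n (powN (qx+1 q)))) k ∎

module PowerSeries where
  open import Data.Nat using (_∸_)
  open import Data.Rational using (ℚ; 0ℚ; 1ℚ; _+_; _*_; _-_; -_; ≢-nonZero)
  open import Data.Rational.Properties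
  open import Data.Rational.Solver using (module +-*-Solver)
  open import Data.List using ([_]; _∷_; zipWith; map; applyUpTo; upTo)
  open import Data.List.Properties using (map-applyUpTo; zipWith-comm)
  open import Data.Empty using (⊥-elim)
  open import Relation.Nullary using (yes; no)
  open import Relation.Binary.PropositionalEquality using (_≗_)
  open import Function using (id; _∘_)
  open +-*-Solver
  open ≡-Reasoning

  tail : Series → Series
  tail a n = a (suc n)

  _+ˢ_ : Series → Series → Series
  (a +ˢ b) n = a n + b n

  scale : ℚ → Series → Series
  scale c a n = c * a n

  mulX : Series → Series
  mulX a zero    = 0ℚ
  mulX a (suc n) = a n

  partialSums : Series → Series
  partialSums a zero    = a 0
  partialSums a (suc n) = partialSums a n + a (suc n)

  ·-zero : ∀ a b → (a · b) 0 ≡ a 0 * b 0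
  ·-zero a b = +-identityʳ (a 0 * b 0)

  -- Induction on the index through this equation replaces every manipulation of double sums
  -- in the laws of _·_ below.
  ·-suc : ∀ a b n → (a · b) (suc n) ≡ a 0 * b (suc n) + (tail a · b) n
  ·-suc a b n = cong (λ xs → a 0 * b (suc n) + sumQ xs)
                     (trans (map-applyUpTo suc (λ i → a i * b (suc n ∸ i)) (suc n))
                            (sym (map-applyUpTo id (λ i → a (suc i) * b (n ∸ i)) (suc n))))

  ·-congˡ : ∀ {a a′} b → a ≗ a′ → a · b ≗ a′ · b
  ·-congˡ b a≗a′ zero = cong (λ x → x * b 0 + 0ℚ) (a≗a′ 0)
  ·-congˡ {a} {a′} b a≗a′ (suc n) = begin
    (a · b) (suc n)                    ≡⟨ ·-suc a b n ⟩
    a 0 * b (suc n) + (tail a · b) n   ≡⟨ cong₂ (λ x y → x * b (suc n) + y) (a≗a′ 0) (·-congˡ b (a≗a′ ∘ suc) n) ⟩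
    a′ 0 * b (suc n) + (tail a′ · b) n ≡⟨ ·-suc a′ b n ⟨
    (a′ · b) (suc n)                   ∎

  ·-congʳ : ∀ a {b b′} → b ≗ b′ → a · b ≗ a · b′
  ·-congʳ a b≗b′ zero = cong (λ x → a 0 * x + 0ℚ) (b≗b′ 0)
  ·-congʳ a {b} {b′} b≗b′ (suc n) = begin
    (a · b) (suc n)                    ≡⟨ ·-suc a b n ⟩
    a 0 * b (suc n) + (tail a · b) n   ≡⟨ cong₂ (λ x y → a 0 * x + y) (b≗b′ (suc n)) (·-congʳ (tail a) b≗b′ n) ⟩
    a 0 * b′ (suc n) + (tail a · b′) n ≡⟨ ·-suc a b′ n ⟨
    (a · b′) (suc n)                   ∎

  ·-zeroˡ : ∀ b → (λ _ → 0ℚ) · b ≗ (λ _ → 0ℚ)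
  ·-zeroˡ b zero    = trans (·-zero (λ _ → 0ℚ) b) (*-zeroˡ (b 0))
  ·-zeroˡ b (suc n) = begin
    ((λ _ → 0ℚ) · b) (suc n)              ≡⟨ ·-suc (λ _ → 0ℚ) b n ⟩
    0ℚ * b (suc n) + ((λ _ → 0ℚ) · b) n   ≡⟨ cong₂ _+_ (*-zeroˡ (b (suc n))) (·-zeroˡ b n) ⟩
    0ℚ                                    ∎

  ·-identityˡ : ∀ b → oneS · b ≗ b
  ·-identityˡ b zero    = trans (·-zero oneS b) (*-identityˡ (b 0))
  ·-identityˡ b (suc n) = begin
    (oneS · b) (suc n)                    ≡⟨ ·-suc oneS b n ⟩
    1ℚ * b (suc n) + ((λ _ → 0ℚ) · b) n   ≡⟨ cong₂ _+_ (*-identityˡ (b (suc n))) (·-zeroˡ b n) ⟩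
    b (suc n) + 0ℚ                        ≡⟨ +-identityʳ (b (suc n)) ⟩
    b (suc n)                             ∎

  ·-identityʳ : ∀ a → a · oneS ≗ a
  ·-identityʳ a zero    = trans (·-zero a oneS) (*-identityʳ (a 0))
  ·-identityʳ a (suc n) = begin
    (a · oneS) (suc n)             ≡⟨ ·-suc a oneS n ⟩
    a 0 * 0ℚ + (tail a · oneS) n   ≡⟨ cong₂ _+_ (*-zeroʳ (a 0)) (·-identityʳ (tail a) n) ⟩
    0ℚ + a (suc n)                 ≡⟨ +-identityˡ (a (suc n)) ⟩
    a (suc n)                      ∎

  ·-scaleˡ : ∀ c a b → scale c a · b ≗ scale c (a · b)
  ·-scaleˡ c a b zero    =
    solve 3 (λ c x y → c :* x :* y :+ con 0ℚ := c :* (x :* y :+ con 0ℚ)) refl c (a 0) (b 0)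
  ·-scaleˡ c a b (suc n) = begin
    (scale c a · b) (suc n)
      ≡⟨ ·-suc (scale c a) b n ⟩
    c * a 0 * b (suc n) + (scale c (tail a) · b) n
      ≡⟨ cong (c * a 0 * b (suc n) +_) (·-scaleˡ c (tail a) b n) ⟩
    c * a 0 * b (suc n) + c * (tail a · b) n
      ≡⟨ solve 4 (λ c x y z → c :* x :* y :+ c :* z := c :* (x :* y :+ z)) refl c (a 0) (b (suc n)) _ ⟩
    c * (a 0 * b (suc n) + (tail a · b) n)
      ≡⟨ cong (c *_) (·-suc a b n) ⟨
    c * (a · b) (suc n) ∎

  ·-scaleʳ : ∀ c a b → a · scale c b ≗ scale c (a · b)
  ·-scaleʳ c a b zero    =
    solve 3 (λ c x y → x :* (c :* y) :+ con 0ℚ := c :* (x :* y :+ con 0ℚ)) refl c (a 0) (b 0)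
  ·-scaleʳ c a b (suc n) = begin
    (a · scale c b) (suc n)
      ≡⟨ ·-suc a (scale c b) n ⟩
    a 0 * (c * b (suc n)) + (tail a · scale c b) n
      ≡⟨ cong (a 0 * (c * b (suc n)) +_) (·-scaleʳ c (tail a) b n) ⟩
    a 0 * (c * b (suc n)) + c * (tail a · b) n
      ≡⟨ solve 4 (λ c x y z → x :* (c :* y) :+ c :* z := c :* (x :* y :+ z)) refl c (a 0) (b (suc n)) _ ⟩
    c * (a 0 * b (suc n) + (tail a · b) n)
      ≡⟨ cong (c *_) (·-suc a b n) ⟨
    c * (a · b) (suc n) ∎

  ·-distribʳ-+ˢ : ∀ a a′ b → (a +ˢ a′) · b ≗ (a · b) +ˢ (a′ · b)
  ·-distribʳ-+ˢ a a′ b zero    =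
    solve 3 (λ x x′ y → (x :+ x′) :* y :+ con 0ℚ := (x :* y :+ con 0ℚ) :+ (x′ :* y :+ con 0ℚ))
            refl (a 0) (a′ 0) (b 0)
  ·-distribʳ-+ˢ a a′ b (suc n) = begin
    ((a +ˢ a′) · b) (suc n)
      ≡⟨ ·-suc (a +ˢ a′) b n ⟩
    (a 0 + a′ 0) * b (suc n) + ((tail a +ˢ tail a′) · b) n
      ≡⟨ cong ((a 0 + a′ 0) * b (suc n) +_) (·-distribʳ-+ˢ (tail a) (tail a′) b n) ⟩
    (a 0 + a′ 0) * b (suc n) + ((tail a · b) n + (tail a′ · b) n)
      ≡⟨ solve 5 (λ x x′ y z z′ → (x :+ x′) :* y :+ (z :+ z′) := (x :* y :+ z) :+ (x′ :* y :+ z′))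
               refl (a 0) (a′ 0) (b (suc n)) _ _ ⟩
    (a 0 * b (suc n) + (tail a · b) n) + (a′ 0 * b (suc n) + (tail a′ · b) n)
      ≡⟨ cong₂ _+_ (·-suc a b n) (·-suc a′ b n) ⟨
    (a · b) (suc n) + (a′ · b) (suc n) ∎

  ·-distribˡ-+ˢ : ∀ a b b′ → a · (b +ˢ b′) ≗ (a · b) +ˢ (a · b′)
  ·-distribˡ-+ˢ a b b′ zero    =
    solve 3 (λ x y y′ → x :* (y :+ y′) :+ con 0ℚ := (x :* y :+ con 0ℚ) :+ (x :* y′ :+ con 0ℚ))
            refl (a 0) (b 0) (b′ 0)
  ·-distribˡ-+ˢ a b b′ (suc n) = begin
    (a · (b +ˢ b′)) (suc n)
      ≡⟨ ·-suc a (b +ˢ b′) n ⟩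
    a 0 * (b (suc n) + b′ (suc n)) + (tail a · (b +ˢ b′)) n
      ≡⟨ cong (a 0 * (b (suc n) + b′ (suc n)) +_) (·-distribˡ-+ˢ (tail a) b b′ n) ⟩
    a 0 * (b (suc n) + b′ (suc n)) + ((tail a · b) n + (tail a · b′) n)
      ≡⟨ solve 5 (λ x y y′ z z′ → x :* (y :+ y′) :+ (z :+ z′) := (x :* y :+ z) :+ (x :* y′ :+ z′))
               refl (a 0) (b (suc n)) (b′ (suc n)) _ _ ⟩
    (a 0 * b (suc n) + (tail a · b) n) + (a 0 * b′ (suc n) + (tail a · b′) n)
      ≡⟨ cong₂ _+_ (·-suc a b n) (·-suc a b′ n) ⟨
    (a · b) (suc n) + (a · b′) (suc n) ∎

  ·-mulXˡ : ∀ a b → mulX a · b ≗ mulX (a · b)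
  ·-mulXˡ a b zero    = trans (·-zero (mulX a) b) (*-zeroˡ (b 0))
  ·-mulXˡ a b (suc n) = begin
    (mulX a · b) (suc n)         ≡⟨ ·-suc (mulX a) b n ⟩
    0ℚ * b (suc n) + (a · b) n   ≡⟨ cong (_+ (a · b) n) (*-zeroˡ (b (suc n))) ⟩
    0ℚ + (a · b) n               ≡⟨ +-identityˡ ((a · b) n) ⟩
    (a · b) n                    ∎

  ·-mulXʳ : ∀ a b → a · mulX b ≗ mulX (a · b)
  ·-mulXʳ a b zero          = trans (·-zero a (mulX b)) (*-zeroʳ (a 0))
  ·-mulXʳ a b (suc zero)    = begin
    (a · mulX b) 1                    ≡⟨ ·-suc a (mulX b) 0 ⟩
    a 0 * b 0 + (tail a · mulX b) 0   ≡⟨ cong (a 0 * b 0 +_) (·-mulXʳ (tail a) b 0) ⟩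
    a 0 * b 0 + 0ℚ                    ∎
  ·-mulXʳ a b (suc (suc n)) = begin
    (a · mulX b) (suc (suc n))                   ≡⟨ ·-suc a (mulX b) (suc n) ⟩
    a 0 * b (suc n) + (tail a · mulX b) (suc n)  ≡⟨ cong (a 0 * b (suc n) +_) (·-mulXʳ (tail a) b (suc n)) ⟩
    a 0 * b (suc n) + (tail a · b) n             ≡⟨ ·-suc a b n ⟨
    (a · b) (suc n)                              ∎

  partialSums-unique : ∀ {x} y → x 0 ≡ y 0 → (∀ n → x (suc n) ≡ x n + y (suc n)) → x ≗ partialSums y
  partialSums-unique     y x₀ x-step zero    = x₀
  partialSums-unique {x} y x₀ x-step (suc n) =
    trans (x-step n) (cong (_+ y (suc n)) (partialSums-unique {x} y x₀ x-step n))

  partialSums-cong : ∀ {y y′} → y ≗ y′ → partialSums y ≗ partialSums y′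
  partialSums-cong {y} y≗y′ =
    partialSums-unique _ (y≗y′ 0) (λ n → cong (partialSums y n +_) (y≗y′ (suc n)))

  ·-partialSumsʳ : ∀ a b → a · partialSums b ≗ partialSums (a · b)
  ·-partialSumsʳ a b = partialSums-unique (a · b) refl step
    where
    unfold : partialSums b ≗ b +ˢ mulX (partialSums b)
    unfold zero    = sym (+-identityʳ (b 0))
    unfold (suc n) = +-comm (partialSums b n) (b (suc n))

    step : ∀ n → (a · partialSums b) (suc n) ≡ (a · partialSums b) n + (a · b) (suc n)
    step n = begin
      (a · partialSums b) (suc n)
        ≡⟨ ·-congʳ a unfold (suc n) ⟩
      (a · (b +ˢ mulX (partialSums b))) (suc n)
        ≡⟨ ·-distribˡ-+ˢ a b (mulX (partialSums b)) (suc n) ⟩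
      (a · b) (suc n) + (a · mulX (partialSums b)) (suc n)
        ≡⟨ cong ((a · b) (suc n) +_) (·-mulXʳ a (partialSums b) (suc n)) ⟩
      (a · b) (suc n) + (a · partialSums b) n
        ≡⟨ +-comm ((a · b) (suc n)) _ ⟩
      (a · partialSums b) n + (a · b) (suc n) ∎

  IsLinear : Series → Set
  IsLinear a = ∀ i → a (suc (suc i)) ≡ 0ℚ

  ·-linearˡ : ∀ a b → IsLinear a → a · b ≗ scale (a 0) b +ˢ scale (a 1) (mulX b)
  ·-linearˡ a b a-linear zero    = cong (a 0 * b 0 +_) (sym (*-zeroʳ (a 1)))
  ·-linearˡ a b a-linear (suc n) = begin
    (a · b) (suc n)                              ≡⟨ ·-suc a b n ⟩
    a 0 * b (suc n) + (tail a · b) n             ≡⟨ cong (a 0 * b (suc n) +_) (·-congˡ b tail-a n) ⟩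
    a 0 * b (suc n) + (scale (a 1) oneS · b) n   ≡⟨ cong (a 0 * b (suc n) +_) (·-scaleˡ (a 1) oneS b n) ⟩
    a 0 * b (suc n) + a 1 * (oneS · b) n         ≡⟨ cong (λ x → a 0 * b (suc n) + a 1 * x) (·-identityˡ b n) ⟩
    a 0 * b (suc n) + a 1 * b n                  ∎
    where
    tail-a : tail a ≗ scale (a 1) oneS
    tail-a zero    = sym (*-identityʳ (a 1))
    tail-a (suc i) = trans (a-linear i) (sym (*-zeroʳ (a 1)))

  ·-assoc-linear : ∀ a b c → IsLinear a → (a · b) · c ≗ a · (b · c)
  ·-assoc-linear a b c a-linear n = begin
    ((a · b) · c) n
      ≡⟨ ·-congˡ c (·-linearˡ a b a-linear) n ⟩
    ((scale (a 0) b +ˢ scale (a 1) (mulX b)) · c) n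
      ≡⟨ ·-distribʳ-+ˢ (scale (a 0) b) (scale (a 1) (mulX b)) c n ⟩
    (scale (a 0) b · c) n + (scale (a 1) (mulX b) · c) n
      ≡⟨ cong₂ _+_ (·-scaleˡ (a 0) b c n) (·-scaleˡ (a 1) (mulX b) c n) ⟩
    a 0 * (b · c) n + a 1 * (mulX b · c) n
      ≡⟨ cong (λ x → a 0 * (b · c) n + a 1 * x) (·-mulXˡ b c n) ⟩
    a 0 * (b · c) n + a 1 * mulX (b · c) n
      ≡⟨ ·-linearˡ a (b · c) a-linear n ⟨
    (a · (b · c)) n ∎

  ·-partialSums-cancel : ∀ a b → IsLinear a → a 1 ≡ - a 0 → a · partialSums b ≗ scale (a 0) b
  ·-partialSums-cancel a b a-linear a₁ n = trans (·-linearˡ a (partialSums b) a-linear n) (telescope n)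
    where
    telescope : ∀ n → a 0 * partialSums b n + a 1 * mulX (partialSums b) n ≡ a 0 * b n
    telescope zero    = trans (cong (a 0 * b 0 +_) (*-zeroʳ (a 1))) (+-identityʳ _)
    telescope (suc n) = begin
      a 0 * (partialSums b n + b (suc n)) + a 1 * partialSums b n
        ≡⟨ cong (λ x → a 0 * (partialSums b n + b (suc n)) + x * partialSums b n) a₁ ⟩
      a 0 * (partialSums b n + b (suc n)) + - a 0 * partialSums b n
        ≡⟨ solve 3 (λ x s y → x :* (s :+ y) :+ (:- x) :* s := x :* y) refl (a 0) (partialSums b n) (b (suc n)) ⟩
      a 0 * b (suc n) ∎

  zipWith-applyUpTo : ∀ {A B C : Set} (f : A → B → C) g h k →
                      zipWith f (applyUpTo g k) (applyUpTo h k) ≡ applyUpTo (λ i → f (g i) (h i)) k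
  zipWith-applyUpTo f g h zero    = refl
  zipWith-applyUpTo f g h (suc k) = cong (f (g 0) (h 0) ∷_) (zipWith-applyUpTo f (g ∘ suc) (h ∘ suc) k)

  sumQ-map-zero : ∀ (g : ℕ → ℚ) f k → (∀ i → g (f i) ≡ 0ℚ) → sumQ (map g (applyUpTo f k)) ≡ 0ℚ
  sumQ-map-zero g f zero    _       = refl
  sumQ-map-zero g f (suc k) g∘f≡0 =
    trans (cong₂ _+_ (g∘f≡0 0) (sumQ-map-zero g (f ∘ suc) k (g∘f≡0 ∘ suc))) (+-identityʳ 0ℚ)

  invUpTo-coefficients : ∀ a b c → c * a 0 ≡ 1ℚ → a · b ≗ oneS →
                         ∀ n → invUpTo a c n ≡ applyUpTo (λ i → b (n ∸ i)) (suc n)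
  invUpTo-coefficients a b c ca≡1 ab≗1 zero = cong [_] (begin
    c               ≡⟨ *-identityʳ c ⟨
    c * 1ℚ          ≡⟨ cong (c *_) (trans (sym (ab≗1 0)) (·-zero a b)) ⟩
    c * (a 0 * b 0) ≡⟨ *-assoc c (a 0) (b 0) ⟨
    c * a 0 * b 0   ≡⟨ cong (_* b 0) ca≡1 ⟩
    1ℚ * b 0        ≡⟨ *-identityˡ (b 0) ⟩
    b 0             ∎)
  invUpTo-coefficients a b c ca≡1 ab≗1 (suc n) =
    cong₂ _∷_ next (invUpTo-coefficients a b c ca≡1 ab≗1 n)
    where
    reversed-b = applyUpTo (λ i → b (n ∸ i)) (suc n)

    reorder : zipWith _*_ reversed-b (map (tail a) (upTo (suc n)))
            ≡ map (λ i → a (suc i) * b (n ∸ i)) (upTo (suc n))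
    reorder = begin
      zipWith _*_ reversed-b (map (tail a) (upTo (suc n)))
        ≡⟨ cong (zipWith _*_ reversed-b) (map-applyUpTo id (tail a) (suc n)) ⟩
      zipWith _*_ reversed-b (applyUpTo (tail a) (suc n))
        ≡⟨ zipWith-comm _*_ *-comm reversed-b _ ⟩
      zipWith _*_ (applyUpTo (tail a) (suc n)) reversed-b
        ≡⟨ zipWith-applyUpTo _*_ (tail a) (λ i → b (n ∸ i)) (suc n) ⟩
      applyUpTo (λ i → a (suc i) * b (n ∸ i)) (suc n)
        ≡⟨ map-applyUpTo id (λ i → a (suc i) * b (n ∸ i)) (suc n) ⟨
      map (λ i → a (suc i) * b (n ∸ i)) (upTo (suc n)) ∎

    next : - c * sumQ (zipWith _*_ (invUpTo a c n) (map (tail a) (upTo (suc n)))) ≡ b (suc n)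
    next = begin
      - c * sumQ (zipWith _*_ (invUpTo a c n) (map (tail a) (upTo (suc n))))
        ≡⟨ cong (λ bs → - c * sumQ (zipWith _*_ bs (map (tail a) (upTo (suc n)))))
                (invUpTo-coefficients a b c ca≡1 ab≗1 n) ⟩
      - c * sumQ (zipWith _*_ reversed-b (map (tail a) (upTo (suc n))))
        ≡⟨ cong (λ xs → - c * sumQ xs) reorder ⟩
      - c * (tail a · b) n
        ≡⟨ solve 4 (λ c a₀ x s → (:- c) :* s := c :* a₀ :* x :- c :* (a₀ :* x :+ s))
                 refl c (a 0) (b (suc n)) _ ⟩
      c * a 0 * b (suc n) - c * (a 0 * b (suc n) + (tail a · b) n)
        ≡⟨ cong₂ (λ x y → x * b (suc n) - c * y) ca≡1 (trans (sym (·-suc a b n)) (ab≗1 (suc n))) ⟩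
      1ℚ * b (suc n) - c * 0ℚ
        ≡⟨ solve 2 (λ c x → con 1ℚ :* x :- c :* con 0ℚ := x) refl c (b (suc n)) ⟩
      b (suc n) ∎

  inv-unique : ∀ a b → a · b ≗ oneS → inv a ≗ b
  inv-unique a b ab≗1 n with a 0 ≟ 0ℚ
  ... | yes a₀≡0 = ⊥-elim (1≢0 (begin
    1ℚ          ≡⟨ ab≗1 0 ⟨
    (a · b) 0   ≡⟨ ·-zero a b ⟩
    a 0 * b 0   ≡⟨ cong (_* b 0) a₀≡0 ⟩
    0ℚ * b 0    ≡⟨ *-zeroˡ (b 0) ⟩
    0ℚ          ∎))
  ... | no  a₀≢0 = cong headQ (invUpTo-coefficients a b _ (*-inverseˡ (a 0) {{≢-nonZero a₀≢0}}) ab≗1 n)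

module RationalEmbedding where
  import Data.Nat as ℕ
  import Data.Nat.Properties as ℕ
  open import Data.Integer as ℤ using (ℤ; +_)
  import Data.Integer.Properties as ℤ
  open import Data.Integer.Solver using (module +-*-Solver)
  open import Data.Rational using (ℚ; 0ℚ; 1ℚ; _+_; _*_; _/_; toℚᵘ)
  open import Data.Rational.Properties using (toℚᵘ-injective; toℚᵘ-fromℚᵘ; toℚᵘ-homo-+; toℚᵘ-homo-*; toℚᵘ-cong)
  open import Data.Rational.Unnormalised as ℚᵘ using (mkℚᵘ; *≡*; _≃_)
  import Data.Rational.Unnormalised.Properties as ℚᵘ
  open import Relation.Nullary using (¬_)
  open +-*-Solver
  open ℚᵘ.≃-Reasoning

  ι : ℤ → ℚ
  ι i = i / 1

  toℚᵘ-ι : ∀ i → toℚᵘ (ι i) ≃ mkℚᵘ i 0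
  toℚᵘ-ι i = toℚᵘ-fromℚᵘ (mkℚᵘ i 0)

  ι-+ : ∀ i j → ι (i ℤ.+ j) ≡ ι i + ι j
  ι-+ i j = toℚᵘ-injective (begin
    toℚᵘ (ι (i ℤ.+ j))          ≈⟨ toℚᵘ-ι (i ℤ.+ j) ⟩
    mkℚᵘ (i ℤ.+ j) 0            ≈⟨ *≡* (solve 2 (λ i j → (i :+ j) :* con (+ 1)
                                                   := (i :* con (+ 1) :+ j :* con (+ 1)) :* con (+ 1)) refl i j) ⟩
    mkℚᵘ i 0 ℚᵘ.+ mkℚᵘ j 0      ≈⟨ ℚᵘ.+-cong (toℚᵘ-ι i) (toℚᵘ-ι j) ⟨
    toℚᵘ (ι i) ℚᵘ.+ toℚᵘ (ι j)  ≈⟨ toℚᵘ-homo-+ (ι i) (ι j) ⟨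
    toℚᵘ (ι i + ι j)            ∎)

  ι-* : ∀ i j → ι (i ℤ.* j) ≡ ι i * ι j
  ι-* i j = toℚᵘ-injective (begin
    toℚᵘ (ι (i ℤ.* j))          ≈⟨ toℚᵘ-ι (i ℤ.* j) ⟩
    mkℚᵘ (i ℤ.* j) 0            ≈⟨ *≡* refl ⟩
    mkℚᵘ i 0 ℚᵘ.* mkℚᵘ j 0      ≈⟨ ℚᵘ.*-cong (toℚᵘ-ι i) (toℚᵘ-ι j) ⟨
    toℚᵘ (ι i) ℚᵘ.* toℚᵘ (ι j)  ≈⟨ toℚᵘ-homo-* (ι i) (ι j) ⟨
    toℚᵘ (ι i * ι j)            ∎)

  ℕtoℚ-+ : ∀ a b → ℕtoℚ (a ℕ.+ b) ≡ ℕtoℚ a + ℕtoℚ b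
  ℕtoℚ-+ a b = ι-+ (+ a) (+ b)

  ℕtoℚ-* : ∀ a b → ℕtoℚ (a ℕ.* b) ≡ ℕtoℚ a * ℕtoℚ b
  ℕtoℚ-* a b = trans (cong ι (ℤ.pos-* a b)) (ι-* (+ a) (+ b))

  ℕtoℚ-+-difference : ∀ m q → ℕtoℚ m + ι (+ q ℤ.- + m) ≡ ℕtoℚ q
  ℕtoℚ-+-difference m q =
    trans (sym (ι-+ (+ m) (+ q ℤ.- + m))) (cong ι (solve 2 (λ m q → m :+ (q :- m) := q) refl (+ m) (+ q)))

  ℕtoℚ-*-recip : ∀ q .{{_ : NonZero q}} → ℕtoℚ q * (+ 1 / q) ≡ 1ℚ
  ℕtoℚ-*-recip (suc q) = toℚᵘ-injective (begin
    toℚᵘ (ℕtoℚ (suc q) * (+ 1 / suc q))          ≈⟨ toℚᵘ-homo-* (ℕtoℚ (suc q)) (+ 1 / suc q) ⟩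
    toℚᵘ (ℕtoℚ (suc q)) ℚᵘ.* toℚᵘ (+ 1 / suc q)  ≈⟨ ℚᵘ.*-cong (toℚᵘ-ι (+ suc q)) (toℚᵘ-fromℚᵘ (mkℚᵘ (+ 1) q)) ⟩
    mkℚᵘ (+ suc q) 0 ℚᵘ.* mkℚᵘ (+ 1) q           ≈⟨ *≡* (cong (λ n → + suc n) q*1*1≡q+0+0) ⟩
    ℚᵘ.1ℚᵘ                                       ∎)
    where
    q*1*1≡q+0+0 : q ℕ.* 1 ℕ.* 1 ≡ q ℕ.+ 0 ℕ.+ 0
    q*1*1≡q+0+0 = trans (ℕ.*-identityʳ (q ℕ.* 1))
                        (trans (ℕ.*-identityʳ q) (sym (trans (ℕ.+-identityʳ (q ℕ.+ 0)) (ℕ.+-identityʳ q))))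

  ℕtoℚ-nonzero : ∀ m .{{_ : NonZero m}} → ¬ (ℕtoℚ m ≡ 0ℚ)
  ℕtoℚ-nonzero (suc m) m≡0 with ℚᵘ.≃-trans (ℚᵘ.≃-sym (toℚᵘ-ι (+ suc m))) (toℚᵘ-cong m≡0)
  ... | *≡* ()

module RiordanForm where
  import Data.Nat as ℕ
  import Data.Nat.Properties as ℕ
  open import Data.Integer as ℤ using ()
  open import Data.Rational using (ℚ; 0ℚ; 1ℚ; _+_; _*_; -_; _/_; 1/_; ≢-nonZero)
  open import Data.Rational.Properties
    using (_≟_; *-assoc; *-comm; *-identityˡ; *-identityʳ; *-zeroˡ; *-zeroʳ; +-identityˡ; +-identityʳ; *-inverseˡ; 1≢0)
  open import Data.Rational.Solver using (module +-*-Solver)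
  open import Data.List using (map; applyUpTo)
  open import Data.Empty using (⊥-elim)
  open import Relation.Binary.PropositionalEquality using (_≗_)
  open import Relation.Nullary using (¬_; yes; no)
  open PowerSeries
  open RationalEmbedding
  open +-*-Solver
  open ≡-Reasoning

  module Denominators (q : ℕ) .{{_ : NonZero q}} where

    q̂ : ℚ
    q̂ = ℕtoℚ q

    1/q : ℚ
    1/q = ℤ.+ 1 / q

    q̂*1/q : q̂ * 1/q ≡ 1ℚ
    q̂*1/q = ℕtoℚ-*-recip q

    1/q*[q̂*x] : ∀ x → 1/q * (q̂ * x) ≡ x
    1/q*[q̂*x] x = begin
      1/q * (q̂ * x)   ≡⟨ *-assoc 1/q q̂ x ⟨
      1/q * q̂ * x     ≡⟨ cong (_* x) (trans (*-comm 1/q q̂) q̂*1/q) ⟩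
      1ℚ * x          ≡⟨ *-identityˡ x ⟩
      x               ∎

    q̂*[1/q*x] : ∀ x → q̂ * (1/q * x) ≡ x
    q̂*[1/q*x] x = begin
      q̂ * (1/q * x)   ≡⟨ *-assoc q̂ 1/q x ⟨
      q̂ * 1/q * x     ≡⟨ cong (_* x) q̂*1/q ⟩
      1ℚ * x          ≡⟨ *-identityˡ x ⟩
      x               ∎

    ωS-linear : IsLinear (ωS q)
    ωS-linear _ = refl

    ωS-nonzero : ¬ (ωS q 0 ≡ 0ℚ)
    ωS-nonzero ω₀≡0 = 1≢0 (begin
      1ℚ       ≡⟨ q̂*1/q ⟨
      q̂ * 1/q  ≡⟨ cong (q̂ *_) ω₀≡0 ⟩
      q̂ * 0ℚ   ≡⟨ *-zeroʳ q̂ ⟩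
      0ℚ       ∎)

    -- Q j = q^j / (1 - x)^j, the inverse of ω^j.
    Q : ℕ → Series
    Q zero    = oneS
    Q (suc j) = partialSums (scale q̂ (Q j))

    powS-ωS-·-Q : ∀ j → powS (ωS q) j · Q j ≗ oneS
    powS-ωS-·-Q zero      = ·-identityˡ oneS
    powS-ωS-·-Q (suc j) n = begin
      ((ωS q · powS (ωS q) j) · Q (suc j)) n  ≡⟨ ·-assoc-linear (ωS q) (powS (ωS q) j) (Q (suc j)) ωS-linear n ⟩
      (ωS q · (powS (ωS q) j · Q (suc j))) n  ≡⟨ ·-congʳ (ωS q) inner n ⟩
      (ωS q · partialSums (scale q̂ oneS)) n   ≡⟨ ·-partialSums-cancel (ωS q) (scale q̂ oneS) ωS-linear refl n ⟩
      1/q * (q̂ * oneS n)                      ≡⟨ 1/q*[q̂*x] (oneS n) ⟩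
      oneS n                                  ∎
      where
      inner : powS (ωS q) j · Q (suc j) ≗ partialSums (scale q̂ oneS)
      inner t = trans (·-partialSumsʳ (powS (ωS q) j) (scale q̂ (Q j)) t)
                      (partialSums-cong (λ s → trans (·-scaleʳ q̂ (powS (ωS q) j) (Q j) s)
                                                     (cong (q̂ *_) (powS-ωS-·-Q j s))) t)

    constant-1/q : (λ _ → 1/q) ≗ partialSums (scale 1/q oneS)
    constant-1/q = partialSums-unique (scale 1/q oneS) (sym (*-identityʳ 1/q))
                     (λ _ → sym (trans (cong (1/q +_) (*-zeroʳ 1/q)) (+-identityʳ 1/q)))

    q[1-x]·1/q : ∀ d → IsLinear d → d 0 ≡ q̂ → d 1 ≡ - q̂ → d · (λ _ → 1/q) ≗ oneS
    q[1-x]·1/q d d-linear d₀ d₁ n = begin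
      (d · (λ _ → 1/q)) n                   ≡⟨ ·-congʳ d constant-1/q n ⟩
      (d · partialSums (scale 1/q oneS)) n  ≡⟨ ·-partialSums-cancel d (scale 1/q oneS) d-linear d₁≡-d₀ n ⟩
      d 0 * (1/q * oneS n)                  ≡⟨ cong (_* (1/q * oneS n)) d₀ ⟩
      q̂ * (1/q * oneS n)                    ≡⟨ q̂*[1/q*x] (oneS n) ⟩
      oneS n                                ∎
      where
      d₁≡-d₀ : d 1 ≡ - d 0
      d₁≡-d₀ = trans d₁ (cong -_ (sym d₀))

    headQ-invUpTo-q[1-x] : ∀ d c → IsLinear d → d 0 ≡ q̂ → d 1 ≡ - q̂ → c * d 0 ≡ 1ℚ →
                           ∀ n → headQ (invUpTo d c n) ≡ 1/q
    headQ-invUpTo-q[1-x] d c d-linear d₀ d₁ cd≡1 n =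
      cong headQ (invUpTo-coefficients d (λ _ → 1/q) c cd≡1 (q[1-x]·1/q d d-linear d₀ d₁) n)

  module _ (m q : ℕ) .{{_ : NonZero q}} where
    open Denominators q
    open IteratedCones m q using (f-zero-zero; f-suc-zero; f-suc-suc; f-above-diagonal)

    q-m : ℚ
    q-m = ι (ℤ.+ q ℤ.- ℤ.+ m)

    -- The numerator and denominator of αS are local to the where-block of its definition and
    -- cannot be named, so αS is evaluated in normal form, after splitting on the test inside inv.
    -- There the denominator d and the tail G of the convolution sum occur only in positions from
    -- which unification recovers them.
    q*αS-zero : q̂ * αS m q 0 ≡ ℕtoℚ m
    q*αS-zero with q̂ ≟ 0ℚ
    ... | yes q̂≡0 = ⊥-elim (ℕtoℚ-nonzero q q̂≡0)
    ... | no  q̂≢0 = cancel (*-inverseˡ q̂ {{≢-nonZero q̂≢0}})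
      where
      cancel : ∀ {c} → c * q̂ ≡ 1ℚ → q̂ * (ℕtoℚ m * c + 0ℚ) ≡ ℕtoℚ m
      cancel {c} cq̂≡1 = begin
        q̂ * (ℕtoℚ m * c + 0ℚ) ≡⟨ solve 3 (λ q̂ m c → q̂ :* (m :* c :+ con 0ℚ) := m :* (c :* q̂))
                                         refl q̂ (ℕtoℚ m) c ⟩
        ℕtoℚ m * (c * q̂)      ≡⟨ cong (ℕtoℚ m *_) cq̂≡1 ⟩
        ℕtoℚ m * 1ℚ           ≡⟨ *-identityʳ (ℕtoℚ m) ⟩
        ℕtoℚ m                ∎

    q*αS-suc-normal-form :
      .{{_ : Data.Rational.NonZero q̂}} → ∀ d G t → IsLinear d → d 0 ≡ q̂ → d 1 ≡ - q̂ →
      (∀ i → G (suc (suc i)) ≡ 0ℚ * headQ (invUpTo d (1/ q̂) (t ℕ.∸ suc i))) →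
      q̂ * (ℕtoℚ m * headQ (invUpTo d (1/ q̂) (suc t))
           + (q-m * headQ (invUpTo d (1/ q̂) t) + sumQ (map G (applyUpTo (λ i → suc (suc i)) t))))
      ≡ q̂
    q*αS-suc-normal-form d G t d-linear d₀ d₁ G-values = begin
      q̂ * (ℕtoℚ m * h (suc t) + (q-m * h t + sumQ (map G (applyUpTo (λ i → suc (suc i)) t))))
        ≡⟨ cong₂ (λ x y → q̂ * (ℕtoℚ m * x + y)) (h≡1/q (suc t))
                 (cong₂ (λ x y → q-m * x + y) (h≡1/q t) (sumQ-map-zero G _ t G-vanishes)) ⟩
      q̂ * (ℕtoℚ m * 1/q + (q-m * 1/q + 0ℚ))
        ≡⟨ solve 4 (λ q̂ m d x → q̂ :* (m :* x :+ (d :* x :+ con 0ℚ)) := q̂ :* (x :* (m :+ d)))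
                 refl q̂ (ℕtoℚ m) q-m 1/q ⟩
      q̂ * (1/q * (ℕtoℚ m + q-m))
        ≡⟨ q̂*[1/q*x] (ℕtoℚ m + q-m) ⟩
      ℕtoℚ m + q-m
        ≡⟨ ℕtoℚ-+-difference m q ⟩
      q̂ ∎
      where
      h : ℕ → ℚ
      h n = headQ (invUpTo d (1/ q̂) n)

      h≡1/q : ∀ n → h n ≡ 1/q
      h≡1/q = headQ-invUpTo-q[1-x] d (1/ q̂) d-linear d₀ d₁ (trans (cong (1/ q̂ *_) d₀) (*-inverseˡ q̂))

      G-vanishes : ∀ i → G (suc (suc i)) ≡ 0ℚ
      G-vanishes i = trans (G-values i) (*-zeroˡ (h (t ℕ.∸ suc i)))

    q*αS-suc : ∀ t → q̂ * αS m q (suc t) ≡ q̂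
    q*αS-suc t with q̂ ≟ 0ℚ
    ... | yes q̂≡0 = ⊥-elim (ℕtoℚ-nonzero q q̂≡0)
    ... | no  q̂≢0 = q*αS-suc-normal-form {{≢-nonZero q̂≢0}} _ _ t (λ _ → refl) refl refl (λ _ → refl)

    αS-nonzero : .{{_ : NonZero m}} → ¬ (αS m q 0 ≡ 0ℚ)
    αS-nonzero α₀≡0 = ℕtoℚ-nonzero m (begin
      ℕtoℚ m         ≡⟨ q*αS-zero ⟨
      q̂ * αS m q 0   ≡⟨ cong (q̂ *_) α₀≡0 ⟩
      q̂ * 0ℚ         ≡⟨ *-zeroʳ q̂ ⟩
      0ℚ             ∎)

    ℕtoℚ-+-q* : ∀ a b → ℕtoℚ (a ℕ.+ q ℕ.* b) ≡ ℕtoℚ a + q̂ * ℕtoℚ b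
    ℕtoℚ-+-q* a b = trans (ℕtoℚ-+ a (q ℕ.* b)) (cong (ℕtoℚ a +_) (ℕtoℚ-* q b))

    -- column (suc j) is column j of F read downwards from its diagonal entry; column 0 = αS is
    -- the term before it in the recursion column-suc.
    column : ℕ → Series
    column zero      = αS m q
    column (suc j) t = ℕtoℚ (f m q (t ℕ.+ j) j)

    column-suc : ∀ j → column (suc j) ≗ partialSums (scale q̂ (column j))
    column-suc zero = partialSums-unique (scale q̂ (αS m q)) (trans (cong ℕtoℚ f-zero-zero) (sym q*αS-zero)) step
      where
      step : ∀ t → ℕtoℚ (f m q (suc (t ℕ.+ 0)) 0) ≡ ℕtoℚ (f m q (t ℕ.+ 0) 0) + q̂ * αS m q (suc t)
      step t = begin
        ℕtoℚ (f m q (suc (t ℕ.+ 0)) 0)           ≡⟨ cong ℕtoℚ (f-suc-zero (t ℕ.+ 0)) ⟩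
        ℕtoℚ (f m q (t ℕ.+ 0) 0 ℕ.+ q)           ≡⟨ ℕtoℚ-+ (f m q (t ℕ.+ 0) 0) q ⟩
        ℕtoℚ (f m q (t ℕ.+ 0) 0) + q̂             ≡⟨ cong (ℕtoℚ (f m q (t ℕ.+ 0) 0) +_) (q*αS-suc t) ⟨
        ℕtoℚ (f m q (t ℕ.+ 0) 0) + q̂ * αS m q (suc t) ∎
    column-suc (suc j) = partialSums-unique (scale q̂ (column (suc j))) base step
      where
      base : ℕtoℚ (f m q (suc j) (suc j)) ≡ q̂ * ℕtoℚ (f m q j j)
      base = begin
        ℕtoℚ (f m q (suc j) (suc j))                   ≡⟨ cong ℕtoℚ (f-suc-suc j j) ⟩
        ℕtoℚ (f m q j (suc j) ℕ.+ q ℕ.* f m q j j)     ≡⟨ ℕtoℚ-+-q* (f m q j (suc j)) (f m q j j) ⟩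
        ℕtoℚ (f m q j (suc j)) + q̂ * ℕtoℚ (f m q j j)  ≡⟨ cong (λ x → ℕtoℚ x + q̂ * ℕtoℚ (f m q j j))
                                                               (f-above-diagonal (ℕ.n<1+n j)) ⟩
        0ℚ + q̂ * ℕtoℚ (f m q j j)                      ≡⟨ +-identityˡ _ ⟩
        q̂ * ℕtoℚ (f m q j j)                           ∎

      step : ∀ t → ℕtoℚ (f m q (suc (t ℕ.+ suc j)) (suc j))
                   ≡ ℕtoℚ (f m q (t ℕ.+ suc j) (suc j)) + q̂ * ℕtoℚ (f m q (suc (t ℕ.+ j)) j)
      step t = begin
        ℕtoℚ (f m q (suc (t ℕ.+ suc j)) (suc j))
          ≡⟨ cong ℕtoℚ (f-suc-suc (t ℕ.+ suc j) j) ⟩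
        ℕtoℚ (f m q (t ℕ.+ suc j) (suc j) ℕ.+ q ℕ.* f m q (t ℕ.+ suc j) j)
          ≡⟨ ℕtoℚ-+-q* (f m q (t ℕ.+ suc j) (suc j)) (f m q (t ℕ.+ suc j) j) ⟩
        ℕtoℚ (f m q (t ℕ.+ suc j) (suc j)) + q̂ * ℕtoℚ (f m q (t ℕ.+ suc j) j)
          ≡⟨ cong (λ n → ℕtoℚ (f m q (t ℕ.+ suc j) (suc j)) + q̂ * ℕtoℚ (f m q n j)) (ℕ.+-suc t j) ⟩
        ℕtoℚ (f m q (t ℕ.+ suc j) (suc j)) + q̂ * ℕtoℚ (f m q (suc (t ℕ.+ j)) j) ∎

    αS-·-Q : ∀ j → αS m q · Q j ≗ column j
    αS-·-Q zero      = ·-identityʳ (αS m q)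
    αS-·-Q (suc j) t = begin
      (αS m q · partialSums (scale q̂ (Q j))) t
        ≡⟨ ·-partialSumsʳ (αS m q) (scale q̂ (Q j)) t ⟩
      partialSums (αS m q · scale q̂ (Q j)) t
        ≡⟨ partialSums-cong (λ s → trans (·-scaleʳ q̂ (αS m q) (Q j) s) (cong (q̂ *_) (αS-·-Q j s))) t ⟩
      partialSums (scale q̂ (column j)) t
        ≡⟨ column-suc j t ⟨
      column (suc j) t ∎

    Fmat-entries : ∀ i j → Fmat m q i j ≡ T (αS m q) (ωS q) i j
    Fmat-entries i j with i ℕ.<? j
    ... | yes i<j = cong ℕtoℚ (f-above-diagonal i<j)
    ... | no  i≮j = sym (begin
      (αS m q · inv (powS (ωS q) (suc j))) (i ℕ.∸ j)
        ≡⟨ ·-congʳ (αS m q) (inv-unique (powS (ωS q) (suc j)) (Q (suc j)) (powS-ωS-·-Q (suc j))) (i ℕ.∸ j) ⟩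
      (αS m q · Q (suc j)) (i ℕ.∸ j)
        ≡⟨ αS-·-Q (suc j) (i ℕ.∸ j) ⟩
      ℕtoℚ (f m q (i ℕ.∸ j ℕ.+ j) j)
        ≡⟨ cong (λ n → ℕtoℚ (f m q n j)) (ℕ.m∸n+n≡m (ℕ.≮⇒≥ i≮j)) ⟩
      ℕtoℚ (f m q i j) ∎)

open import Data.Nat using (_+_; _*_; _^_)
open IteratedCones
open FPolynomial
open RiordanForm
open Denominators using (ωS-nonzero)

theorem5p2 : (m q : ℕ) → .{{_ : NonZero m}} → .{{_ : NonZero q}} →
    -- (a)
    ((∀ k → P m q 0 k ≡ constN m k) ×
     (∀ n k → P m q (suc n) k ≡ ((qx+1 q ⊛ P m q n) ⊕ constN q) k)) ×
    -- (b)
    IsRiordanT (Fmat m q) (αS m q) (ωS q) ×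
    -- (c)
    (f m q 0 0 ≡ m ×
     (∀ n → f m q (suc n) 0 ≡ f m q n 0 + q) ×
     (∀ n k → f m q (suc n) (suc k) ≡ f m q n (suc k) + q * f m q n k)) ×
    -- (d)
    (∀ n k → f m q n k ≡ (q * (n C suc k) + m * (n C k)) * q ^ k) ×
    -- (e)
    (∀ n k → P m q n k ≡ ((constN m ⊛ powN (qx+1 q) n) ⊕ (constN q ⊛ sumPolyN n (powN (qx+1 q)))) k)
theorem5p2 m q =
  (P-zero m q , P-suc m q) ,
  (αS-nonzero m q , ωS-nonzero q , Fmat-entries m q) ,
  (f-zero-zero m q , f-suc-zero m q , f-suc-suc m q) ,
  f-closed m q ,
  P-closed m q
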